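{- Let $(C_n,\mathbf{w})$ and $(C_m,\mathbf{w}')$ be weighted cycles ($n,m\ge 3$) with edge weights $w_1,\dots,w_n$ and $w'_1,\dots,w'_m$ respectively, such that at least one of $\sum_{i=1}^n w_i$ and $\sum_{i=1}^m w'_i$ is even. Then $c\big(C_n\square C_m,\mathbf{w}\square\mathbf{w}'\big)=c(C_n,\mathbf{w})+c(C_m,\mathbf{w}')$.
   Context: A weighted graph is a finite simple graph with positive integer edge weights that is weight-minimal: every edge is a shortest path between its endpoints. $d_\mathbf{w}$ is the weighted shortest-path distance. A binary addressing of length $m$ is a map $f:V\to\{0,1\}^m$ with $d_\mathbf{w}(u,v)\le d_H(f(u),f(v))$ for all $u,v$ ($d_H$ Hamming distance); $c(G,\mathbf{w})$ is the minimum such $m$. The weighted Cartesian product $(G_1\square G_2,\mathbf{w}_1\square\mathbf{w}_2)$ has vertex set $V(G_1)\times V(G_2)$; $(u,x)$ and $(v,x)$ are joined by an edge of weight $\mathbf{w}_1(uv)$ when $uv\in E(G_1)$, and $(u,x)$ and $(u,y)$ by an edge of weight $\mathbf{w}_2(xy)$ when $xy\in E(G_2)$. -}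

module Defs where

open import Data.Nat using (ℕ; zero; suc; _+_; _∸_; _≤_)
open import Data.Fin using (Fin; toℕ) renaming (zero to fzero; suc to fsuc)
open import Data.Bool using (Bool; true; false)
open import Data.Vec using (Vec; []; _∷_)
open import Data.Product using (Σ; _×_; _,_)
open import Data.Sum using (_⊎_)
open import Relation.Binary.PropositionalEquality using (_≡_)

-- A weighted graph: vertex type and a weighted edge relation
-- (E u v w : "u and v are joined by an edge of weight w").
record WGraph : Set₁ where
  field
    V : Set
    E : V → V → ℕ → Set
open WGraph public

data Walk (G : WGraph) : V G → V G → ℕ → Set where
  nil  : ∀ {u} → Walk G u u 0
  cons : ∀ {u v x w l} → E G u v w → Walk G v x l → Walk G u x (w + l)

IsDist : (G : WGraph) → V G → V G → ℕ → Set
IsDist G u v d = Walk G u v d × (∀ l → Walk G u v l → d ≤ l)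

WeightMinimal : WGraph → Set
WeightMinimal G = ∀ u v w → E G u v w → IsDist G u v w

hamming : ∀ {m} → Vec Bool m → Vec Bool m → ℕ
hamming [] [] = 0
hamming (true ∷ xs) (true ∷ ys) = hamming xs ys
hamming (false ∷ xs) (false ∷ ys) = hamming xs ys
hamming (true ∷ xs) (false ∷ ys) = suc (hamming xs ys)
hamming (false ∷ xs) (true ∷ ys) = suc (hamming xs ys)

IsAddressing : (G : WGraph) (m : ℕ) → (V G → Vec Bool m) → Set
IsAddressing G m f = ∀ u v d → IsDist G u v d → d ≤ hamming (f u) (f v)

HasAddressing : WGraph → ℕ → Set
HasAddressing G m = Σ (V G → Vec Bool m) (IsAddressing G m)

IsAddressingNumber : WGraph → ℕ → Set
IsAddressingNumber G k = HasAddressing G k × (∀ m → HasAddressing G m → k ≤ m)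

CycSucc : (n : ℕ) → Fin n → Fin n → Set
CycSucc n i j = (toℕ j ≡ suc (toℕ i)) ⊎ ((toℕ i ≡ n ∸ 1) × (toℕ j ≡ 0))

-- weighted cycle C_n: vertices 0..n-1, edge i -- i+1 (mod n) has weight w i
Cycle : (n : ℕ) → (Fin n → ℕ) → WGraph
Cycle n w = record
  { V = Fin n
  ; E = λ i j x → (CycSucc n i j × x ≡ w i) ⊎ (CycSucc n j i × x ≡ w j)
  }

_□_ : WGraph → WGraph → WGraph
G □ H = record
  { V = V G × V H
  ; E = λ { (u , x) (v , y) c → (E G u v c × x ≡ y) ⊎ (u ≡ v × E H x y c) }
  }

sumFin : (n : ℕ) → (Fin n → ℕ) → ℕ
sumFin zero f = 0
sumFin (suc n) f = f fzero + sumFin n (λ i → f (fsuc i))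

{-# OPTIONS --safe #-}
module Submission where

-- Concatenating addresses of the factors addresses the product, because distances in a
-- Cartesian product add up; hence c(G □ H) ≤ c(G) + c(H).  Conversely, cutting a weighted
-- cycle of total weight W at three suitable vertices gives a geodesic triangle of perimeter W,
-- the product of two such triangles is a geodesic triangle of perimeter W + W′, and a triangle
-- in the M-cube has perimeter at most 2M; so W + W′ ≤ 2M for every addressing of length M.
-- Since the cycle of length 2K sits isometrically in the K-cube, c(C, w) ≤ ⌈W/2⌉, and if W or
-- W′ is even then ⌈W/2⌉ + ⌈W′/2⌉ ≤ M follows from W + W′ ≤ 2M.

open import Defs
open import Data.Bool using (Bool; true; false; not)
open import Data.Fin using (Fin; toℕ; fromℕ; fromℕ<) renaming (zero to fzero; suc to fsuc)
open import Data.Fin.Properties using (toℕ-injective; toℕ-fromℕ; toℕ-fromℕ<; toℕ<n)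
open import Data.Nat
open import Data.Nat.Divisibility using (_∣_; divides)
open import Data.Nat.Properties
open import Data.Nat.Tactic.RingSolver using (solve-∀)
open import Data.Product using (∃-syntax; _×_; _,_; proj₁; proj₂)
open import Data.Sum using (_⊎_; inj₁; inj₂)
open import Data.Vec using (Vec; []; _∷_; _++_; map)
open import Function using (_∘_)
open import Relation.Nullary using (¬_; yes; no; contradiction)
open import Relation.Unary using (Pred; Decidable)
open import Relation.Binary.PropositionalEquality

2*n≡n+n : ∀ n → 2 * n ≡ n + n
2*n≡n+n n = cong (n +_) (+-identityʳ n)

m≤2*n⇒m∸n≤n : ∀ {m n} → m ≤ 2 * n → m ∸ n ≤ n
m≤2*n⇒m∸n≤n {m} {n} m≤2n = m≤n+o⇒m∸n≤o m n (subst (m ≤_) (2*n≡n+n n) m≤2n)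

-- Hamming distance

hamming-refl : ∀ {L} (x : Vec Bool L) → hamming x x ≡ 0
hamming-refl []          = refl
hamming-refl (true ∷ x)  = hamming-refl x
hamming-refl (false ∷ x) = hamming-refl x

hamming-sym : ∀ {L} (x y : Vec Bool L) → hamming x y ≡ hamming y x
hamming-sym []          []          = refl
hamming-sym (true ∷ x)  (true ∷ y)  = hamming-sym x y
hamming-sym (true ∷ x)  (false ∷ y) = cong suc (hamming-sym x y)
hamming-sym (false ∷ x) (true ∷ y)  = cong suc (hamming-sym x y)
hamming-sym (false ∷ x) (false ∷ y) = hamming-sym x y

hamming-triangle : ∀ {L} (x y z : Vec Bool L) → hamming x z ≤ hamming x y + hamming y z
hamming-triangle []          []          []          = z≤n
hamming-triangle (true ∷ x)  (true ∷ y)  (true ∷ z)  = hamming-triangle x y z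
hamming-triangle (false ∷ x) (false ∷ y) (false ∷ z) = hamming-triangle x y z
hamming-triangle (true ∷ x)  (false ∷ y) (false ∷ z) = s≤s (hamming-triangle x y z)
hamming-triangle (false ∷ x) (true ∷ y)  (true ∷ z)  = s≤s (hamming-triangle x y z)
hamming-triangle (true ∷ x)  (true ∷ y)  (false ∷ z) =
  ≤-trans (s≤s (hamming-triangle x y z)) (≤-reflexive (sym (+-suc _ _)))
hamming-triangle (false ∷ x) (false ∷ y) (true ∷ z)  =
  ≤-trans (s≤s (hamming-triangle x y z)) (≤-reflexive (sym (+-suc _ _)))
hamming-triangle (true ∷ x)  (false ∷ y) (true ∷ z)  =
  ≤-trans (hamming-triangle x y z) (+-mono-≤ (n≤1+n _) (n≤1+n _))
hamming-triangle (false ∷ x) (true ∷ y)  (false ∷ z) =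
  ≤-trans (hamming-triangle x y z) (+-mono-≤ (n≤1+n _) (n≤1+n _))

hamming-++ : ∀ {a b} (x x′ : Vec Bool a) (y y′ : Vec Bool b) →
             hamming (x ++ y) (x′ ++ y′) ≡ hamming x x′ + hamming y y′
hamming-++ []          []           y y′ = refl
hamming-++ (true ∷ x)  (true ∷ x′)  y y′ = hamming-++ x x′ y y′
hamming-++ (true ∷ x)  (false ∷ x′) y y′ = cong suc (hamming-++ x x′ y y′)
hamming-++ (false ∷ x) (true ∷ x′)  y y′ = cong suc (hamming-++ x x′ y y′)
hamming-++ (false ∷ x) (false ∷ x′) y y′ = hamming-++ x x′ y y′

hamming-map-not : ∀ {L} (x y : Vec Bool L) → hamming (map not x) y + hamming x y ≡ L
hamming-map-not []          []          = refl
hamming-map-not (true ∷ x)  (true ∷ y)  = cong suc (hamming-map-not x y)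
hamming-map-not (false ∷ x) (false ∷ y) = cong suc (hamming-map-not x y)
hamming-map-not (true ∷ x)  (false ∷ y) = trans (+-suc _ _) (cong suc (hamming-map-not x y))
hamming-map-not (false ∷ x) (true ∷ y)  = trans (+-suc _ _) (cong suc (hamming-map-not x y))

hamming-map-not₂ : ∀ {L} (x y : Vec Bool L) → hamming (map not x) (map not y) ≡ hamming x y
hamming-map-not₂ []          []          = refl
hamming-map-not₂ (true ∷ x)  (true ∷ y)  = hamming-map-not₂ x y
hamming-map-not₂ (true ∷ x)  (false ∷ y) = cong suc (hamming-map-not₂ x y)
hamming-map-not₂ (false ∷ x) (true ∷ y)  = cong suc (hamming-map-not₂ x y)
hamming-map-not₂ (false ∷ x) (false ∷ y) = hamming-map-not₂ x y

hamming-map-notʳ : ∀ {L} (x y : Vec Bool L) → hamming x (map not y) ≡ L ∸ hamming y x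
hamming-map-notʳ {L} x y = begin
  hamming x (map not y)                             ≡⟨ hamming-sym x (map not y) ⟩
  hamming (map not y) x                             ≡⟨ sym (m+n∸n≡m _ (hamming y x)) ⟩
  hamming (map not y) x + hamming y x ∸ hamming y x ≡⟨ cong (_∸ hamming y x) (hamming-map-not y x) ⟩
  L ∸ hamming y x                                   ∎
  where open ≡-Reasoning

-- Detour from y to z through map not x, which is at distance L - d from every point at
-- distance d from x.
hamming-perimeter : ∀ {L} (x y z : Vec Bool L) → hamming x y + hamming y z + hamming z x ≤ 2 * L
hamming-perimeter {L} x y z = begin
  hamming x y + hamming y z + hamming z x
    ≤⟨ +-mono-≤ (+-monoʳ-≤ (hamming x y) (hamming-triangle y x̄ z))
                (≤-reflexive (hamming-sym z x)) ⟩
  hamming x y + (hamming y x̄ + hamming x̄ z) + hamming x z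
    ≡⟨ cong (λ t → hamming x y + (t + hamming x̄ z) + hamming x z) (hamming-sym y x̄) ⟩
  hamming x y + (hamming x̄ y + hamming x̄ z) + hamming x z
    ≡⟨ regroup (hamming x y) (hamming x̄ y) (hamming x̄ z) (hamming x z) ⟩
  (hamming x̄ y + hamming x y) + (hamming x̄ z + hamming x z)
    ≡⟨ cong₂ _+_ (hamming-map-not x y) (hamming-map-not x z) ⟩
  L + L
    ≡⟨ sym (2*n≡n+n L) ⟩
  2 * L ∎
  where
  open ≤-Reasoning
  x̄ = map not x
  regroup : ∀ a b c d → a + (b + c) + d ≡ (b + a) + (c + d)
  regroup = solve-∀

-- The cycle of length 2L in the L-cube

threshold : (L a : ℕ) → Vec Bool L
threshold zero    _       = []
threshold (suc L) zero    = false ∷ threshold L zero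
threshold (suc L) (suc a) = true ∷ threshold L a

hamming-threshold : ∀ {L a b} → a ≤ L → b ≤ L → hamming (threshold L a) (threshold L b) ≡ ∣ a - b ∣
hamming-threshold {zero}  z≤n       z≤n       = refl
hamming-threshold {suc L} {zero}  {zero}  _ _       = hamming-threshold {L} z≤n z≤n
hamming-threshold {suc L} {zero}  {suc b} _ (s≤s b≤L) = cong suc (hamming-threshold z≤n b≤L)
hamming-threshold {suc L} {suc a} {zero}  (s≤s a≤L) _ =
  cong suc (trans (hamming-threshold a≤L z≤n) (∣-∣-identityʳ a))
hamming-threshold {suc L} {suc a} {suc b} (s≤s a≤L) (s≤s b≤L) = hamming-threshold a≤L b≤L

arc : ℕ → ℕ → ℕ
arc N Δ = Δ ⊓ (N ∸ Δ)

arc-short : ∀ {N Δ} → 2 * Δ ≤ N → arc N Δ ≡ Δ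
arc-short {N} {Δ} 2Δ≤N = m≤n⇒m⊓n≡m (m+n≤o⇒m≤o∸n Δ (subst (_≤ N) (2*n≡n+n Δ) 2Δ≤N))

arc-long : ∀ {N Δ} → N ≤ 2 * Δ → arc N Δ ≡ N ∸ Δ
arc-long {N} {Δ} N≤2Δ = m≥n⇒m⊓n≡n (m≤n+o⇒m∸n≤o N Δ (subst (N ≤_) (2*n≡n+n Δ) N≤2Δ))

arc-double : ∀ N Δ → arc (2 * N) (2 * Δ) ≡ 2 * arc N Δ
arc-double N Δ = begin
  (2 * Δ) ⊓ (2 * N ∸ 2 * Δ) ≡⟨ cong ((2 * Δ) ⊓_) (sym (*-distribˡ-∸ 2 N Δ)) ⟩
  (2 * Δ) ⊓ (2 * (N ∸ Δ))   ≡⟨ sym (*-distribˡ-⊓ 2 Δ (N ∸ Δ)) ⟩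
  2 * arc N Δ               ∎
  where open ≡-Reasoning

arc-mono : ∀ {N N′} Δ → N ≤ N′ → arc N Δ ≤ arc N′ Δ
arc-mono Δ N≤N′ = ⊓-monoʳ-≤ Δ (∸-monoˡ-≤ Δ N≤N′)

-- L + r is the antipode of r on the cycle of length 2L.
arc-antipodal : ∀ {L a r Δ} → a + Δ ≡ L + r → arc (2 * L) Δ ≡ L ∸ ∣ a - r ∣
arc-antipodal {L} {a} {r} {Δ} a+Δ≡L+r with ≤-total a r
... | inj₁ a≤r with m≤n⇒∃[o]m+o≡n a≤r
...   | e , refl = begin
  arc (2 * L) Δ       ≡⟨ cong (arc (2 * L)) Δ≡L+e ⟩
  arc (2 * L) (L + e) ≡⟨ arc-long (*-monoʳ-≤ 2 (m≤m+n L e)) ⟩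
  2 * L ∸ (L + e)     ≡⟨ cong (_∸ (L + e)) (2*n≡n+n L) ⟩
  L + L ∸ (L + e)     ≡⟨ [m+n]∸[m+o]≡n∸o L L e ⟩
  L ∸ e               ≡⟨ cong (L ∸_) (sym (∣m-m+n∣≡n a e)) ⟩
  L ∸ ∣ a - a + e ∣   ∎
  where
  open ≡-Reasoning
  Δ≡L+e : Δ ≡ L + e
  Δ≡L+e = +-cancelˡ-≡ a Δ (L + e) (trans a+Δ≡L+r (regroup L a e))
    where
    regroup : ∀ L a e → L + (a + e) ≡ a + (L + e)
    regroup = solve-∀
arc-antipodal {L} {a} {r} {Δ} a+Δ≡L+r | inj₂ r≤a with m≤n⇒∃[o]m+o≡n r≤a
...   | e , refl = begin
  arc (2 * L) Δ     ≡⟨ arc-short (*-monoʳ-≤ 2 (subst (Δ ≤_) e+Δ≡L (m≤n+m Δ e))) ⟩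
  Δ                 ≡⟨ sym (m+n∸m≡n e Δ) ⟩
  e + Δ ∸ e         ≡⟨ cong (_∸ e) e+Δ≡L ⟩
  L ∸ e             ≡⟨ cong (L ∸_) (sym (trans (∣-∣-comm (r + e) r) (∣m-m+n∣≡n r e))) ⟩
  L ∸ ∣ r + e - r ∣ ∎
  where
  open ≡-Reasoning
  e+Δ≡L : e + Δ ≡ L
  e+Δ≡L = +-cancelˡ-≡ r (e + Δ) L (trans (sym (+-assoc r e Δ)) (trans a+Δ≡L+r (+-comm L r)))

-- Vertex q of the cycle of length 2L in the L-cube.
cycleCode : (L q : ℕ) → Vec Bool L
cycleCode L q with q ≤? L
... | yes _ = threshold L q
... | no  _ = map not (threshold L (q ∸ L))

hamming-threshold-arc : ∀ {L a} Δ → a + Δ ≤ L →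
                        hamming (threshold L a) (threshold L (a + Δ)) ≡ arc (2 * L) Δ
hamming-threshold-arc {L} {a} Δ a+Δ≤L = begin
  hamming (threshold L a) (threshold L (a + Δ)) ≡⟨ hamming-threshold (m+n≤o⇒m≤o a a+Δ≤L) a+Δ≤L ⟩
  ∣ a - a + Δ ∣                                 ≡⟨ ∣m-m+n∣≡n a Δ ⟩
  Δ                                             ≡⟨ sym (arc-short 2Δ≤2L) ⟩
  arc (2 * L) Δ                                 ∎
  where
  open ≡-Reasoning
  2Δ≤2L : 2 * Δ ≤ 2 * L
  2Δ≤2L = *-monoʳ-≤ 2 (m+n≤o⇒n≤o a a+Δ≤L)

hamming-cycleCode : ∀ {L a b} Δ → a + Δ ≡ b → b ≤ 2 * L →
                    hamming (cycleCode L a) (cycleCode L b) ≡ arc (2 * L) Δ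
hamming-cycleCode {L} {a} Δ refl a+Δ≤2L with a ≤? L | a + Δ ≤? L
... | yes _   | yes a+Δ≤L = hamming-threshold-arc Δ a+Δ≤L
... | no a≰L  | yes a+Δ≤L = contradiction (m+n≤o⇒m≤o a a+Δ≤L) a≰L
... | no a≰L  | no _      = begin
  hamming (map not (threshold L (a ∸ L))) (map not (threshold L (a + Δ ∸ L)))
    ≡⟨ hamming-map-not₂ (threshold L (a ∸ L)) (threshold L (a + Δ ∸ L)) ⟩
  hamming (threshold L (a ∸ L)) (threshold L (a + Δ ∸ L))
    ≡⟨ cong (hamming (threshold L (a ∸ L)) ∘ threshold L) a+Δ∸L≡a∸L+Δ ⟩
  hamming (threshold L (a ∸ L)) (threshold L (a ∸ L + Δ))
    ≡⟨ hamming-threshold-arc Δ (subst (_≤ L) a+Δ∸L≡a∸L+Δ (m≤2*n⇒m∸n≤n a+Δ≤2L)) ⟩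
  arc (2 * L) Δ ∎
  where
  open ≡-Reasoning
  a+Δ∸L≡a∸L+Δ : a + Δ ∸ L ≡ a ∸ L + Δ
  a+Δ∸L≡a∸L+Δ = +-∸-comm Δ (≰⇒≥ a≰L)
... | yes a≤L | no a+Δ≰L  = begin
  hamming (threshold L a) (map not (threshold L r)) ≡⟨ hamming-map-notʳ _ (threshold L r) ⟩
  L ∸ hamming (threshold L r) (threshold L a)       ≡⟨ cong (L ∸_) (hamming-threshold r≤L a≤L) ⟩
  L ∸ ∣ r - a ∣                                     ≡⟨ cong (L ∸_) (∣-∣-comm r a) ⟩
  L ∸ ∣ a - r ∣                                     ≡⟨ sym (arc-antipodal a+Δ≡L+r) ⟩
  arc (2 * L) Δ                                     ∎
  where
  open ≡-Reasoning
  r = a + Δ ∸ L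
  a+Δ≡L+r : a + Δ ≡ L + r
  a+Δ≡L+r = sym (m+[n∸m]≡n (≰⇒≥ a+Δ≰L))
  r≤L : r ≤ L
  r≤L = m≤2*n⇒m∸n≤n a+Δ≤2L

-- Walks, distances and Cartesian products

Undirected : WGraph → Set
Undirected G = ∀ {u v c} → E G u v c → E G v u c

HasDistances : WGraph → Set
HasDistances G = ∀ u v → ∃[ d ] IsDist G u v d

module _ {G : WGraph} where

  infixr 5 _++ʷ_
  _++ʷ_ : ∀ {u v x a b} → Walk G u v a → Walk G v x b → Walk G u x (a + b)
  nil                        ++ʷ q = q
  cons {w = c} {l = l} e p ++ʷ q = subst (Walk G _ _) (sym (+-assoc c l _)) (cons e (p ++ʷ q))

  walk-⊓ : ∀ {u v a b} → Walk G u v a → Walk G u v b → Walk G u v (a ⊓ b)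
  walk-⊓ {a = a} {b} p q with ⊓-sel a b
  ... | inj₁ a⊓b≡a = subst (Walk G _ _) (sym a⊓b≡a) p
  ... | inj₂ a⊓b≡b = subst (Walk G _ _) (sym a⊓b≡b) q

  reverse : Undirected G → ∀ {u v l} → Walk G u v l → Walk G v u l
  reverse flip nil                        = nil
  reverse flip (cons {w = c} {l = l} e p) =
    subst (Walk G _ _) (trans (cong (l +_) (+-identityʳ c)) (+-comm l c))
                       (reverse flip p ++ʷ cons (flip e) nil)

  isDist-sym : Undirected G → ∀ {u v d} → IsDist G u v d → IsDist G v u d
  isDist-sym flip (p , p-min) = reverse flip p , λ l q → p-min l (reverse flip q)

  hamming-walk-≤ : ∀ {L} k (f : V G → Vec Bool L) →
                   (∀ {u v c} → E G u v c → hamming (f u) (f v) ≤ k * c) →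
                   ∀ {u v l} → Walk G u v l → hamming (f u) (f v) ≤ k * l
  hamming-walk-≤ k f f-edge {u} nil = ≤-reflexive (trans (hamming-refl (f u)) (sym (*-zeroʳ k)))
  hamming-walk-≤ k f f-edge {u} {x} (cons {v = v} {w = c} {l = l} e p) = begin
    hamming (f u) (f x)                       ≤⟨ hamming-triangle (f u) (f v) (f x) ⟩
    hamming (f u) (f v) + hamming (f v) (f x) ≤⟨ +-mono-≤ (f-edge e) (hamming-walk-≤ k f f-edge p) ⟩
    k * c + k * l                             ≡⟨ sym (*-distribˡ-+ k c l) ⟩
    k * (c + l)                               ∎
    where open ≤-Reasoning

  walk-isDist : ∀ {L} k .{{_ : NonZero k}} (f : V G → Vec Bool L) →
                (∀ {u v c} → E G u v c → hamming (f u) (f v) ≤ k * c) →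
                ∀ {u v l} → Walk G u v l → hamming (f u) (f v) ≡ k * l → IsDist G u v l
  walk-isDist k f f-edge p p-tight =
    p , λ _ q → *-cancelˡ-≤ k (≤-trans (≤-reflexive (sym p-tight)) (hamming-walk-≤ k f f-edge q))

module _ {G H : WGraph} where

  walkˡ : ∀ {u v l} (x : V H) → Walk G u v l → Walk (G □ H) (u , x) (v , x) l
  walkˡ x nil        = nil
  walkˡ x (cons e p) = cons (inj₁ (e , refl)) (walkˡ x p)

  walkʳ : ∀ {x y l} (u : V G) → Walk H x y l → Walk (G □ H) (u , x) (u , y) l
  walkʳ u nil        = nil
  walkʳ u (cons e p) = cons (inj₂ (refl , e)) (walkʳ u p)

  unzipWalk : ∀ {s t l} → Walk (G □ H) s t l →
              ∃[ a ] ∃[ b ] Walk G (proj₁ s) (proj₁ t) a × Walk H (proj₂ s) (proj₂ t) b × a + b ≡ l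
  unzipWalk nil = 0 , 0 , nil , nil , refl
  unzipWalk (cons {w = c} (inj₁ (e , refl)) p) with unzipWalk p
  ... | a , b , p₁ , p₂ , a+b≡l =
    c + a , b , cons e p₁ , p₂ , trans (+-assoc c a b) (cong (c +_) a+b≡l)
  unzipWalk (cons {w = c} (inj₂ (refl , e)) p) with unzipWalk p
  ... | a , b , p₁ , p₂ , a+b≡l =
    a , c + b , p₁ , cons e p₂ , trans (swap a c b) (cong (c +_) a+b≡l)
    where
    swap : ∀ a c b → a + (c + b) ≡ c + (a + b)
    swap = solve-∀

  □-isDist : ∀ {u v x y d₁ d₂} → IsDist G u v d₁ → IsDist H x y d₂ →
             IsDist (G □ H) (u , x) (v , y) (d₁ + d₂)
  □-isDist {v = v} {x = x} (p₁ , p₁-min) (p₂ , p₂-min) = walkˡ x p₁ ++ʷ walkʳ v p₂ , shortest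
    where
    shortest : ∀ l → Walk (G □ H) _ _ l → _ ≤ l
    shortest l q with unzipWalk q
    ... | a , b , q₁ , q₂ , refl = +-mono-≤ (p₁-min a q₁) (p₂-min b q₂)

  □-addressing : ∀ {k₁ k₂} → HasDistances G → HasDistances H →
                 HasAddressing G k₁ → HasAddressing H k₂ → HasAddressing (G □ H) (k₁ + k₂)
  □-addressing distG distH (f , f-ok) (g , g-ok) = (λ (u , x) → f u ++ g x) , fg-ok
    where
    fg-ok : IsAddressing (G □ H) _ (λ (u , x) → f u ++ g x)
    fg-ok (u , x) (v , y) d (_ , shortest) with distG u v | distH x y
    ... | d₁ , D₁ | d₂ , D₂ = begin
      d                                         ≤⟨ shortest _ (proj₁ (□-isDist D₁ D₂)) ⟩
      d₁ + d₂                                   ≤⟨ +-mono-≤ (f-ok u v d₁ D₁) (g-ok x y d₂ D₂) ⟩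
      hamming (f u) (f v) + hamming (g x) (g y) ≡⟨ sym (hamming-++ (f u) (f v) (g x) (g y)) ⟩
      hamming (f u ++ g x) (f v ++ g y)         ∎
      where open ≤-Reasoning

record GeodesicTriangle (G : WGraph) (perimeter : ℕ) : Set where
  constructor triangle
  field
    {a b c}       : V G
    {dab dbc dca} : ℕ
    ab            : IsDist G a b dab
    bc            : IsDist G b c dbc
    ca            : IsDist G c a dca
    sum≡perimeter : dab + dbc + dca ≡ perimeter

□-triangle : ∀ {G H P Q} → GeodesicTriangle G P → GeodesicTriangle H Q →
             GeodesicTriangle (G □ H) (P + Q)
□-triangle (triangle {dab = a₁} {a₂} {a₃} ab bc ca refl)
           (triangle {dab = b₁} {b₂} {b₃} ab′ bc′ ca′ refl) =
  triangle (□-isDist ab ab′) (□-isDist bc bc′) (□-isDist ca ca′) (interleave a₁ a₂ a₃ b₁ b₂ b₃)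
  where
  interleave : ∀ a₁ a₂ a₃ b₁ b₂ b₃ →
               (a₁ + b₁) + (a₂ + b₂) + (a₃ + b₃) ≡ (a₁ + a₂ + a₃) + (b₁ + b₂ + b₃)
  interleave = solve-∀

perimeter≤2*length : ∀ {G P M} → GeodesicTriangle G P → HasAddressing G M → P ≤ 2 * M
perimeter≤2*length (triangle {a} {b} {c} {dab} {dbc} {dca} ab bc ca refl) (f , f-ok) =
  ≤-trans (+-mono-≤ (+-mono-≤ (f-ok a b dab ab) (f-ok b c dbc bc)) (f-ok c a dca ca))
          (hamming-perimeter (f a) (f b) (f c))

-- Weighted cycles

position : ∀ {k} → (Fin k → ℕ) → Fin k → ℕ
position w fzero    = 0
position w (fsuc i) = w fzero + position (w ∘ fsuc) i

position-step : ∀ {k} (w : Fin k → ℕ) {i j : Fin k} → toℕ j ≡ suc (toℕ i) →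
                position w j ≡ position w i + w i
position-step w {fzero}  {fsuc fzero} _  = +-identityʳ (w fzero)
position-step w {fsuc i} {fsuc j}     eq = trans
  (cong (w fzero +_) (position-step (w ∘ fsuc) (suc-injective eq)))
  (sym (+-assoc (w fzero) _ _))

position-last : ∀ {k} (w : Fin (suc k) → ℕ) {i} → toℕ i ≡ k → position w i + w i ≡ sumFin (suc k) w
position-last {zero}  w {fzero}  _  = sym (+-identityʳ (w fzero))
position-last {suc k} w {fsuc i} eq =
  trans (+-assoc (w fzero) _ _) (cong (w fzero +_) (position-last (w ∘ fsuc) (suc-injective eq)))

position≤sum : ∀ {k} (w : Fin k → ℕ) i → position w i ≤ sumFin k w
position≤sum w fzero    = z≤n
position≤sum w (fsuc i) = +-monoʳ-≤ (w fzero) (position≤sum (w ∘ fsuc) i)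

exitOrLast : ∀ {n ℓ} (P : Pred (Fin (suc n)) ℓ) → Decidable P → P fzero →
             ∃[ a ] P a × (toℕ a ≡ n ⊎ ∃[ b ] toℕ b ≡ suc (toℕ a) × ¬ P b)
exitOrLast {zero}  P P? P0 = fzero , P0 , inj₁ refl
exitOrLast {suc n} P P? P0 with P? (fsuc fzero)
... | no ¬P1 = fzero , P0 , inj₂ (fsuc fzero , refl , ¬P1)
... | yes P1 with exitOrLast (P ∘ fsuc) (P? ∘ fsuc) P1
...   | a , Pa , inj₁ a≡n                = fsuc a , Pa , inj₁ (cong suc a≡n)
...   | a , Pa , inj₂ (b , b≡a+1 , ¬Pb) = fsuc a , Pa , inj₂ (fsuc b , cong suc b≡a+1 , ¬Pb)

module WeightedCycle {n : ℕ} (w : Fin (suc n) → ℕ) where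

  C : WGraph
  C = Cycle (suc n) w

  W : ℕ
  W = sumFin (suc n) w

  P : Fin (suc n) → ℕ
  P = position w

  last : Fin (suc n)
  last = fromℕ n

  undirected : Undirected C
  undirected (inj₁ e) = inj₂ e
  undirected (inj₂ e) = inj₁ e

  successor : ∀ {i j : Fin (suc n)} k → suc (toℕ i) + k ≡ toℕ j →
              ∃[ i⁺ ] toℕ i⁺ ≡ suc (toℕ i) × toℕ i⁺ + k ≡ toℕ j
  successor {i} {j} k i+1+k≡j = fromℕ< i+1<1+n , toℕ-fromℕ< i+1<1+n ,
                                trans (cong (_+ k) (toℕ-fromℕ< i+1<1+n)) i+1+k≡j
    where
    i+1<1+n : suc (toℕ i) < suc n
    i+1<1+n = ≤-<-trans (m+n≤o⇒m≤o (suc (toℕ i)) (≤-reflexive i+1+k≡j)) (toℕ<n j)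

  forwardWalk : ∀ k {i j : Fin (suc n)} → toℕ i + k ≡ toℕ j → ∃[ Δ ] P i + Δ ≡ P j × Walk C i j Δ
  forwardWalk zero {i} i+0≡j with toℕ-injective (trans (sym (+-identityʳ (toℕ i))) i+0≡j)
  ... | refl = 0 , +-identityʳ (P i) , nil
  forwardWalk (suc k) {i} {j} i+k+1≡j with successor k (trans (sym (+-suc (toℕ i) k)) i+k+1≡j)
  ... | i⁺ , i⁺≡i+1 , i⁺+k≡j with forwardWalk k i⁺+k≡j
  ...   | Δ , Pi⁺+Δ≡Pj , p = w i + Δ , Pi+wi+Δ≡Pj , cons (inj₁ (inj₁ i⁺≡i+1 , refl)) p
    where
    open ≡-Reasoning
    Pi+wi+Δ≡Pj : P i + (w i + Δ) ≡ P j
    Pi+wi+Δ≡Pj = begin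
      P i + (w i + Δ) ≡⟨ sym (+-assoc (P i) (w i) Δ) ⟩
      P i + w i + Δ   ≡⟨ cong (_+ Δ) (sym (position-step w i⁺≡i+1)) ⟩
      P i⁺ + Δ        ≡⟨ Pi⁺+Δ≡Pj ⟩
      P j             ∎

  wrapWalk : ∀ i j → ∃[ μ ] P j + μ ≡ W + P i × Walk C j i μ
  wrapWalk i j with m≤n⇒∃[o]m+o≡n (s≤s⁻¹ (toℕ<n j))
  ... | k , j+k≡n with forwardWalk k {j} {last} (trans j+k≡n (sym (toℕ-fromℕ n)))
                     | forwardWalk (toℕ i) {fzero} {i} refl
  ...   | Δ₁ , Pj+Δ₁≡Pn , p₁ | Δ₂ , refl , p₂ =
    Δ₁ + (w last + Δ₂) , Pj+μ≡W+Pi , p₁ ++ʷ cons (inj₁ (inj₂ (toℕ-fromℕ n , refl) , refl)) p₂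
    where
    open ≡-Reasoning
    regroup : ∀ a b c d → a + (b + (c + d)) ≡ a + b + c + d
    regroup = solve-∀
    Pj+μ≡W+Pi : P j + (Δ₁ + (w last + Δ₂)) ≡ W + Δ₂
    Pj+μ≡W+Pi = begin
      P j + (Δ₁ + (w last + Δ₂)) ≡⟨ regroup (P j) Δ₁ (w last) Δ₂ ⟩
      P j + Δ₁ + w last + Δ₂     ≡⟨ cong (λ t → t + w last + Δ₂) Pj+Δ₁≡Pn ⟩
      P last + w last + Δ₂       ≡⟨ cong (_+ Δ₂) (position-last w (toℕ-fromℕ n)) ⟩
      W + Δ₂                     ∎

  -- Doubling the positions maps the weighted cycle into the cycle of length 2W and doubles
  -- all distances along it; this certifies the cycle distances below.
  ψ : Fin (suc n) → Vec Bool W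
  ψ i = cycleCode W (2 * P i)

  hamming-ψ : ∀ i j {Δ} → P i + Δ ≡ P j → hamming (ψ i) (ψ j) ≡ 2 * arc W Δ
  hamming-ψ i j {Δ} Pi+Δ≡Pj = trans
    (hamming-cycleCode {W} {2 * P i} (2 * Δ) 2Pi+2Δ≡2Pj (*-monoʳ-≤ 2 (position≤sum w j)))
    (arc-double W Δ)
    where
    2Pi+2Δ≡2Pj : 2 * P i + 2 * Δ ≡ 2 * P j
    2Pi+2Δ≡2Pj = trans (sym (*-distribˡ-+ 2 (P i) Δ)) (cong (2 *_) Pi+Δ≡Pj)

  ψ-step : ∀ {i j} → CycSucc (suc n) i j → hamming (ψ i) (ψ j) ≤ 2 * w i
  ψ-step {i} {j} (inj₁ j≡i+1) = begin
    hamming (ψ i) (ψ j) ≡⟨ hamming-ψ i j (sym (position-step w j≡i+1)) ⟩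
    2 * arc W (w i)     ≤⟨ *-monoʳ-≤ 2 (m⊓n≤m (w i) _) ⟩
    2 * w i             ∎
    where open ≤-Reasoning
  ψ-step {i} {j} (inj₂ (i≡n , j≡0)) with toℕ-injective {i = j} {j = fzero} j≡0
  ... | refl = begin
    hamming (ψ i) (ψ fzero) ≡⟨ hamming-sym (ψ i) (ψ fzero) ⟩
    hamming (ψ fzero) (ψ i) ≡⟨ hamming-ψ fzero i refl ⟩
    2 * arc W (P i)         ≤⟨ *-monoʳ-≤ 2 (m⊓n≤n (P i) _) ⟩
    2 * (W ∸ P i)           ≡⟨ cong (λ t → 2 * (t ∸ P i)) (sym (position-last w i≡n)) ⟩
    2 * (P i + w i ∸ P i)   ≡⟨ cong (2 *_) (m+n∸m≡n (P i) (w i)) ⟩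
    2 * w i                 ∎
    where open ≤-Reasoning

  ψ-edge : ∀ {i j c} → E C i j c → hamming (ψ i) (ψ j) ≤ 2 * c
  ψ-edge         (inj₁ (i→j , refl)) = ψ-step i→j
  ψ-edge {i} {j} (inj₂ (j→i , refl)) = subst (_≤ _) (hamming-sym (ψ j) (ψ i)) (ψ-step j→i)

  isDist-arc : ∀ {i j} → toℕ i ≤ toℕ j → ∃[ Δ ] P i + Δ ≡ P j × IsDist C i j (arc W Δ)
  isDist-arc {i} {j} i≤j with m≤n⇒∃[o]m+o≡n i≤j
  ... | k , i+k≡j with forwardWalk k i+k≡j | wrapWalk i j
  ...   | Δ , Pi+Δ≡Pj , p | μ , Pj+μ≡W+Pi , q =
    Δ , Pi+Δ≡Pj , walk-isDist 2 ψ ψ-edge shorterWalk (hamming-ψ i j Pi+Δ≡Pj)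
    where
    open ≡-Reasoning
    Δ+μ≡W : Δ + μ ≡ W
    Δ+μ≡W = +-cancelˡ-≡ (P i) (Δ + μ) W (begin
      P i + (Δ + μ) ≡⟨ sym (+-assoc (P i) Δ μ) ⟩
      P i + Δ + μ   ≡⟨ cong (_+ μ) Pi+Δ≡Pj ⟩
      P j + μ       ≡⟨ Pj+μ≡W+Pi ⟩
      W + P i       ≡⟨ +-comm W (P i) ⟩
      P i + W       ∎)
    W∸Δ≡μ : W ∸ Δ ≡ μ
    W∸Δ≡μ = trans (cong (_∸ Δ) (sym Δ+μ≡W)) (m+n∸m≡n Δ μ)
    shorterWalk : Walk C i j (arc W Δ)
    shorterWalk = subst (Walk C i j) (cong (Δ ⊓_) (sym W∸Δ≡μ)) (walk-⊓ p (reverse undirected q))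

  hasDistances : HasDistances C
  hasDistances i j with ≤-total (toℕ i) (toℕ j)
  ... | inj₁ i≤j = let Δ , _ , D = isDist-arc i≤j in arc W Δ , D
  ... | inj₂ j≤i = let Δ , _ , D = isDist-arc j≤i in arc W Δ , isDist-sym undirected D

  addressing : ∀ K → W ≤ 2 * K → HasAddressing C K
  addressing K W≤2K = φ , φ-ok
    where
    φ : Fin (suc n) → Vec Bool K
    φ i = cycleCode K (P i)

    φ-forward : ∀ {i j d} → toℕ i ≤ toℕ j → IsDist C i j d → d ≤ hamming (φ i) (φ j)
    φ-forward {i} {j} {d} i≤j (_ , shortest) with isDist-arc i≤j
    ... | Δ , Pi+Δ≡Pj , (p , _) = begin
      d                   ≤⟨ shortest _ p ⟩
      arc W Δ             ≤⟨ arc-mono Δ W≤2K ⟩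
      arc (2 * K) Δ       ≡⟨ sym (hamming-cycleCode Δ Pi+Δ≡Pj (≤-trans (position≤sum w j) W≤2K)) ⟩
      hamming (φ i) (φ j) ∎
      where open ≤-Reasoning

    φ-ok : IsAddressing C K φ
    φ-ok i j d D with ≤-total (toℕ i) (toℕ j)
    ... | inj₁ i≤j = φ-forward i≤j D
    ... | inj₂ j≤i =
      subst (d ≤_) (hamming-sym (φ j) (φ i)) (φ-forward j≤i (isDist-sym undirected D))

  isDist-fromStart : ∀ j → IsDist C fzero j (arc W (P j))
  isDist-fromStart j with isDist-arc {fzero} {j} z≤n
  ... | Δ , refl , D = D

  -- Cut the cycle at 0, at a vertex a with 2 P a ≤ W < 2 P (a + 1) (or a = last), and at
  -- a + 1: the arcs 0 → a and a + 1 → 0 are geodesic by the choice of a, and the edge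
  -- a → a + 1 by weight-minimality.
  geodesicTriangle : WeightMinimal C → GeodesicTriangle C W
  geodesicTriangle minimal with exitOrLast (λ a → 2 * P a ≤ W) (λ a → 2 * P a ≤? W) z≤n
  ... | a , 2Pa≤W , inj₁ a≡n = triangle
    (subst (IsDist C fzero a) (arc-short 2Pa≤W) (isDist-fromStart a))
    (minimal a fzero (w a) (inj₁ (inj₂ (a≡n , refl) , refl)))
    (nil , λ _ _ → z≤n)
    (trans (+-identityʳ _) (position-last w a≡n))
  ... | a , 2Pa≤W , inj₂ (b , b≡a+1 , 2Pb≰W) = triangle
    (subst (IsDist C fzero a) (arc-short 2Pa≤W) (isDist-fromStart a))
    (minimal a b (w a) (inj₁ (inj₁ b≡a+1 , refl)))
    (isDist-sym undirected (subst (IsDist C fzero b) (arc-long (≰⇒≥ 2Pb≰W)) (isDist-fromStart b)))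
    (begin
      P a + w a + (W ∸ P b) ≡⟨ cong (_+ (W ∸ P b)) (sym (position-step w b≡a+1)) ⟩
      P b + (W ∸ P b)       ≡⟨ m+[n∸m]≡n (position≤sum w b) ⟩
      W                     ∎)
    where open ≡-Reasoning

⌈m*2+n/2⌉≡m+⌈n/2⌉ : ∀ m n → ⌈ m * 2 + n /2⌉ ≡ m + ⌈ n /2⌉
⌈m*2+n/2⌉≡m+⌈n/2⌉ zero    n = refl
⌈m*2+n/2⌉≡m+⌈n/2⌉ (suc m) n = cong suc (⌈m*2+n/2⌉≡m+⌈n/2⌉ m n)

⌈2*n/2⌉≡n : ∀ n → ⌈ 2 * n /2⌉ ≡ n
⌈2*n/2⌉≡n n = trans (cong ⌈_/2⌉ (2*n≡n+n n)) (sym (n≡⌈n+n/2⌉ n))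

n≤2*⌈n/2⌉ : ∀ n → n ≤ 2 * ⌈ n /2⌉
n≤2*⌈n/2⌉ n = begin
  n                       ≡⟨ sym (⌊n/2⌋+⌈n/2⌉≡n n) ⟩
  ⌊ n /2⌋ + ⌈ n /2⌉       ≤⟨ +-monoˡ-≤ ⌈ n /2⌉ (⌊n/2⌋≤⌈n/2⌉ n) ⟩
  ⌈ n /2⌉ + ⌈ n /2⌉       ≡⟨ sym (2*n≡n+n ⌈ n /2⌉) ⟩
  2 * ⌈ n /2⌉             ∎
  where open ≤-Reasoning

⌈/2⌉+⌈/2⌉≤ˡ : ∀ {m n k} → 2 ∣ m → m + n ≤ 2 * k → ⌈ m /2⌉ + ⌈ n /2⌉ ≤ k
⌈/2⌉+⌈/2⌉≤ˡ {_} {n} {k} (divides q refl) q*2+n≤2k = begin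
  ⌈ q * 2 /2⌉ + ⌈ n /2⌉ ≡⟨ cong (_+ ⌈ n /2⌉) (trans (cong ⌈_/2⌉ (*-comm q 2)) (⌈2*n/2⌉≡n q)) ⟩
  q + ⌈ n /2⌉           ≡⟨ sym (⌈m*2+n/2⌉≡m+⌈n/2⌉ q n) ⟩
  ⌈ q * 2 + n /2⌉       ≤⟨ ⌈n/2⌉-mono q*2+n≤2k ⟩
  ⌈ 2 * k /2⌉           ≡⟨ ⌈2*n/2⌉≡n k ⟩
  k                     ∎
  where open ≤-Reasoning

⌈/2⌉+⌈/2⌉≤ : ∀ {m n k} → (2 ∣ m) ⊎ (2 ∣ n) → m + n ≤ 2 * k → ⌈ m /2⌉ + ⌈ n /2⌉ ≤ k
⌈/2⌉+⌈/2⌉≤ (inj₁ 2∣m) m+n≤2k = ⌈/2⌉+⌈/2⌉≤ˡ 2∣m m+n≤2k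
⌈/2⌉+⌈/2⌉≤ {m} {n} {k} (inj₂ 2∣n) m+n≤2k =
  subst (_≤ k) (+-comm ⌈ n /2⌉ ⌈ m /2⌉) (⌈/2⌉+⌈/2⌉≤ˡ 2∣n (subst (_≤ 2 * k) (+-comm m n) m+n≤2k))

theorem8 : (n m : ℕ) → 3 ≤ n → 3 ≤ m
    → (w : Fin n → ℕ) → (w′ : Fin m → ℕ)
    → (∀ i → 0 < w i) → (∀ i → 0 < w′ i)
    → WeightMinimal (Cycle n w) → WeightMinimal (Cycle m w′)
    → (2 ∣ sumFin n w) ⊎ (2 ∣ sumFin m w′)
    → (k₁ k₂ : ℕ)
    → IsAddressingNumber (Cycle n w) k₁
    → IsAddressingNumber (Cycle m w′) k₂
    → IsAddressingNumber (Cycle n w □ Cycle m w′) (k₁ + k₂)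
theorem8 (suc _) (suc _) (s≤s _) (s≤s _) w w′ _ _ minimal minimal′ even k₁ k₂
         (A , A-least) (A′ , A′-least) =
  □-addressing G.hasDistances G′.hasDistances A A′ , least
  where
  module G  = WeightedCycle w
  module G′ = WeightedCycle w′
  least : ∀ M → HasAddressing (G.C □ G′.C) M → k₁ + k₂ ≤ M
  least M B = begin
    k₁ + k₂                ≤⟨ +-mono-≤ (A-least _ (G.addressing ⌈ G.W /2⌉ (n≤2*⌈n/2⌉ G.W)))
                                       (A′-least _ (G′.addressing ⌈ G′.W /2⌉ (n≤2*⌈n/2⌉ G′.W))) ⟩
    ⌈ G.W /2⌉ + ⌈ G′.W /2⌉ ≤⟨ ⌈/2⌉+⌈/2⌉≤ even (perimeter≤2*length productTriangle B) ⟩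
    M                      ∎
    where
    open ≤-Reasoning
    productTriangle : GeodesicTriangle (G.C □ G′.C) (G.W + G′.W)
    productTriangle = □-triangle (G.geodesicTriangle minimal) (G′.geodesicTriangle minimal′)
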